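{- Let $T$ be a set of $\mathsf{DFNL^*}$-formulas containing the two distinguished propositional letters $p_\bot$ and $p_\top$ and closed under subformulas. Then every sequent of the form $\Gamma[p_\bot]\Rightarrow A$ or $\Gamma\Rightarrow p_\top$ (with $\Gamma$ a formula tree) all of whose formulas belong to $c(T)$ is derivable from $\Theta[T]$ in $\mathsf{DFNL^*}$.
   Context: $\mathsf{DFNL^*}$: formulas $A::=p\mid A\wedge B\mid A\vee B\mid A\cdot B\mid A\backslash B\mid A/B$; formula trees $\Gamma::=A\mid\Gamma\circ\Delta$ (nonempty); $\Gamma[\Delta]$ denotes a tree with a distinguished occurrence of subtree $\Delta$; sequents $\Gamma\Rightarrow A$ with $\Gamma$ a tree or empty. Axioms: $A\Rightarrow A$; $A\wedge(B\vee C)\Rightarrow(A\wedge B)\vee(A\wedge C)$. Rules: from $\Delta\Rightarrow A$, $\Gamma[B]\Rightarrow C$ infer $\Gamma[\Delta\circ(A\backslash B)]\Rightarrow C$; from $A\circ\Gamma\Rightarrow B$ infer $\Gamma\Rightarrow A\backslash B$; from $\Gamma[A]\Rightarrow C$, $\Delta\Rightarrow B$ infer $\Gamma[(A/B)\circ\Delta]\Rightarrow C$; from $\Gamma\circ B\Rightarrow A$ infer $\Gamma\Rightarrow A/B$ ($\Gamma$ may be empty in these two); from $\Gamma[A\circ B]\Rightarrow C$ infer $\Gamma[A\cdot B]\Rightarrow C$; from $\Gamma\Rightarrow A$, $\Delta\Rightarrow B$ infer $\Gamma\circ\Delta\Rightarrow A\cdot B$; Cut: from $\Delta\Rightarrow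 A$, $\Gamma[A]\Rightarrow B$ infer $\Gamma[\Delta]\Rightarrow B$; from $\Gamma[A_i]\Rightarrow B$ infer $\Gamma[A_1\wedge A_2]\Rightarrow B$; from $\Gamma\Rightarrow A$, $\Gamma\Rightarrow B$ infer $\Gamma\Rightarrow A\wedge B$; from $\Gamma[A_1]\Rightarrow B$, $\Gamma[A_2]\Rightarrow B$ infer $\Gamma[A_1\vee A_2]\Rightarrow B$; from $\Gamma\Rightarrow A_i$ infer $\Gamma\Rightarrow A_1\vee A_2$. "Derivable from $\Phi$" means derivable using the sequents of $\Phi$ as extra axioms. $c(T)$ is the closure of $T$ under $\wedge,\vee$. $\Theta[T]$ is the set of all sequents $p_\bot\Rightarrow A$, $A\circ p_\bot\Rightarrow p_\bot$, $p_\bot\circ A\Rightarrow p_\bot$, $A\Rightarrow p_\top$, $A\circ p_\top\Rightarrow p_\top$, $p_\top\circ A\Rightarrow p_\top$ for $A\in T$. -}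

module Defs where

open import Data.Nat using (ℕ)
open import Data.Maybe using (Maybe; just; nothing)
open import Data.Product using (_×_)

data Atom : Set where
  p⊥ p⊤ : Atom
  var   : ℕ → Atom

infixr 30 _·_
infixr 25 _∧_ _∨_
infixr 20 _\\_
infixl 20 _/_
data Formula : Set where
  at   : Atom → Formula
  _∧_ _∨_ _·_ _\\_ _/_ : Formula → Formula → Formula

infixl 15 _∘_
data Tree : Set where
  leaf : Formula → Tree
  _∘_  : Tree → Tree → Tree

data Ctx : Set where
  hole : Ctx
  _◂_  : Ctx → Tree → Ctx
  _▸_  : Tree → Ctx → Ctx

_[_] : Ctx → Tree → Tree
hole    [ Δ ] = Δ
(Γ ◂ Σ) [ Δ ] = (Γ [ Δ ]) ∘ Σ
(Σ ▸ Γ) [ Δ ] = Σ ∘ (Γ [ Δ ])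

-- sequents Γ ⇒ A, antecedent a tree or empty (nothing)
infix 10 _⇒_
record Sequent : Set where
  constructor _⇒_
  field
    ant : Maybe Tree
    suc : Formula

data Der (Φ : Sequent → Set) : Sequent → Set where
  ext  : ∀ {s} → Φ s → Der Φ s
  id   : ∀ A → Der Φ (just (leaf A) ⇒ A)
  dist : ∀ A B C → Der Φ (just (leaf (A ∧ (B ∨ C))) ⇒ (A ∧ B) ∨ (A ∧ C))
  \\L  : ∀ {Γ Δ A B C} → Der Φ (just Δ ⇒ A) → Der Φ (just (Γ [ leaf B ]) ⇒ C)
         → Der Φ (just (Γ [ Δ ∘ leaf (A \\ B) ]) ⇒ C)
  \\R  : ∀ {Γ A B} → Der Φ (just (leaf A ∘ Γ) ⇒ B) → Der Φ (just Γ ⇒ A \\ B)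
  \\R₀ : ∀ {A B} → Der Φ (just (leaf A) ⇒ B) → Der Φ (nothing ⇒ A \\ B)
  /L   : ∀ {Γ Δ A B C} → Der Φ (just (Γ [ leaf A ]) ⇒ C) → Der Φ (just Δ ⇒ B)
         → Der Φ (just (Γ [ leaf (A / B) ∘ Δ ]) ⇒ C)
  /R   : ∀ {Γ A B} → Der Φ (just (Γ ∘ leaf B) ⇒ A) → Der Φ (just Γ ⇒ A / B)
  /R₀  : ∀ {A B} → Der Φ (just (leaf B) ⇒ A) → Der Φ (nothing ⇒ A / B)
  ·L   : ∀ {Γ A B C} → Der Φ (just (Γ [ leaf A ∘ leaf B ]) ⇒ C)
         → Der Φ (just (Γ [ leaf (A · B) ]) ⇒ C)
  ·R   : ∀ {Γ Δ A B} → Der Φ (just Γ ⇒ A) → Der Φ (just Δ ⇒ B)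
         → Der Φ (just (Γ ∘ Δ) ⇒ A · B)
  cut  : ∀ {Γ Δ A B} → Der Φ (just Δ ⇒ A) → Der Φ (just (Γ [ leaf A ]) ⇒ B)
         → Der Φ (just (Γ [ Δ ]) ⇒ B)
  ∧L₁  : ∀ {Γ A₁ A₂ B} → Der Φ (just (Γ [ leaf A₁ ]) ⇒ B)
         → Der Φ (just (Γ [ leaf (A₁ ∧ A₂) ]) ⇒ B)
  ∧L₂  : ∀ {Γ A₁ A₂ B} → Der Φ (just (Γ [ leaf A₂ ]) ⇒ B)
         → Der Φ (just (Γ [ leaf (A₁ ∧ A₂) ]) ⇒ B)
  ∧R   : ∀ {Γ A B} → Der Φ (Γ ⇒ A) → Der Φ (Γ ⇒ B) → Der Φ (Γ ⇒ A ∧ B)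
  ∨L   : ∀ {Γ A₁ A₂ B} → Der Φ (just (Γ [ leaf A₁ ]) ⇒ B)
         → Der Φ (just (Γ [ leaf A₂ ]) ⇒ B)
         → Der Φ (just (Γ [ leaf (A₁ ∨ A₂) ]) ⇒ B)
  ∨R₁  : ∀ {Γ A₁ A₂} → Der Φ (Γ ⇒ A₁) → Der Φ (Γ ⇒ A₁ ∨ A₂)
  ∨R₂  : ∀ {Γ A₁ A₂} → Der Φ (Γ ⇒ A₂) → Der Φ (Γ ⇒ A₁ ∨ A₂)

SubClosed : (Formula → Set) → Set
SubClosed T = ∀ {A B} →
  (T (A ∧ B) → T A × T B) × (T (A ∨ B) → T A × T B) ×
  (T (A · B) → T A × T B) × (T (A \\ B) → T A × T B) ×
  (T (A / B) → T A × T B)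

data c (T : Formula → Set) : Formula → Set where
  base : ∀ {A} → T A → c T A
  and  : ∀ {A B} → c T A → c T B → c T (A ∧ B)
  or   : ∀ {A B} → c T A → c T B → c T (A ∨ B)

AllIn : (Formula → Set) → Tree → Set
AllIn P (leaf A) = P A
AllIn P (Γ ∘ Δ)  = AllIn P Γ × AllIn P Δ

data Θ (T : Formula → Set) : Sequent → Set where
  θ₁ : ∀ {A} → T A → Θ T (just (leaf (at p⊥)) ⇒ A)
  θ₂ : ∀ {A} → T A → Θ T (just (leaf A ∘ leaf (at p⊥)) ⇒ at p⊥)
  θ₃ : ∀ {A} → T A → Θ T (just (leaf (at p⊥) ∘ leaf A) ⇒ at p⊥)
  θ₄ : ∀ {A} → T A → Θ T (just (leaf A) ⇒ at p⊤)
  θ₅ : ∀ {A} → T A → Θ T (just (leaf A ∘ leaf (at p⊤)) ⇒ at p⊤)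
  θ₆ : ∀ {A} → T A → Θ T (just (leaf (at p⊤) ∘ leaf A) ⇒ at p⊤)

module Submission where

open import Defs
open import Data.Maybe using (just)
open import Data.Product using (_×_; _,_)

-- Every antecedent built from c(T) collapses to p⊤, and p⊤ is absorbed by a
-- neighbouring p⊥ (Θ-axioms with A = p⊤), so Γ[p⊥] ⇒ p⊥; finally p⊥ ⇒ A for
-- every A ∈ c(T), starting from the axioms p⊥ ⇒ A with A ∈ T.

∘-cut : ∀ {Φ Γ Δ A B C} → Der Φ (just Γ ⇒ A) → Der Φ (just Δ ⇒ B) →
        Der Φ (just (leaf A ∘ leaf B) ⇒ C) → Der Φ (just (Γ ∘ Δ) ⇒ C)
∘-cut {Γ = Γ} Γ⇒A Δ⇒B AB⇒C =
  cut {Γ = Γ ▸ hole} Δ⇒B (cut {Γ = hole ◂ leaf _} Γ⇒A AB⇒C)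

module _ {T : Formula → Set} where

  p⊥⇒c : ∀ {A} → c T A → Der (Θ T) (just (leaf (at p⊥)) ⇒ A)
  p⊥⇒c (base A∈T) = ext (θ₁ A∈T)
  p⊥⇒c (and A B)  = ∧R (p⊥⇒c A) (p⊥⇒c B)
  p⊥⇒c (or A _)   = ∨R₁ (p⊥⇒c A)

  c⇒p⊤ : ∀ {A} → c T A → Der (Θ T) (just (leaf A) ⇒ at p⊤)
  c⇒p⊤ (base A∈T) = ext (θ₄ A∈T)
  c⇒p⊤ (and A _)  = ∧L₁ {Γ = hole} (c⇒p⊤ A)
  c⇒p⊤ (or A B)   = ∨L {Γ = hole} (c⇒p⊤ A) (c⇒p⊤ B)

  module _ (p⊤∈T : T (at p⊤)) where

    tree⇒p⊤ : (Γ : Tree) → AllIn (c T) Γ → Der (Θ T) (just Γ ⇒ at p⊤)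
    tree⇒p⊤ (leaf A) A∈cT = c⇒p⊤ A∈cT
    tree⇒p⊤ (Γ ∘ Δ) (Γ∈cT , Δ∈cT) =
      ∘-cut (tree⇒p⊤ Γ Γ∈cT) (tree⇒p⊤ Δ Δ∈cT) (ext (θ₅ p⊤∈T))

    ctx[p⊥]⇒p⊥ : (Γ : Ctx) → AllIn (c T) (Γ [ leaf (at p⊥) ]) →
                 Der (Θ T) (just (Γ [ leaf (at p⊥) ]) ⇒ at p⊥)
    ctx[p⊥]⇒p⊥ hole _ = id (at p⊥)
    ctx[p⊥]⇒p⊥ (Γ ◂ Σ) (Γ∈cT , Σ∈cT) =
      ∘-cut (ctx[p⊥]⇒p⊥ Γ Γ∈cT) (tree⇒p⊤ Σ Σ∈cT) (ext (θ₃ p⊤∈T))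
    ctx[p⊥]⇒p⊥ (Σ ▸ Γ) (Σ∈cT , Γ∈cT) =
      ∘-cut (tree⇒p⊤ Σ Σ∈cT) (ctx[p⊥]⇒p⊥ Γ Γ∈cT) (ext (θ₂ p⊤∈T))

lemma8 : (T : Formula → Set) → T (at p⊥) → T (at p⊤) → SubClosed T →
    ((Γ : Ctx) (A : Formula) → AllIn (c T) (Γ [ leaf (at p⊥) ]) → c T A →
      Der (Θ T) (just (Γ [ leaf (at p⊥) ]) ⇒ A))
    × ((Γ : Tree) → AllIn (c T) Γ → Der (Θ T) (just Γ ⇒ at p⊤))
lemma8 T _ p⊤∈T _ =
  (λ Γ A Γ∈cT A∈cT → cut {Γ = hole} (ctx[p⊥]⇒p⊥ p⊤∈T Γ Γ∈cT) (p⊥⇒c A∈cT))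
  , tree⇒p⊤ p⊤∈T
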